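{- Let $G$ be a finite simple graph with $\gamma_\infty(G) = 1$. Then $\gamma_{\mathrm{aut}}(G) = 1$.
   Context: For $G=(V,E)$: two dominating sets $S,S'$ are adjacent if there are $v\in S$, $v'\in S'$ with $vv'\in E$ and $S'=(S\setminus\{v\})\cup\{v'\}$. A collection $\mathcal{F}$ of subsets of $V$ is an autonomously dominating family if: (1) every member is a dominating set; (2) for each $S\in\mathcal{F}$ and each $v\in V\setminus S$ there is $S'\in\mathcal{F}$ adjacent to $S$ with $v\in S'$; (3) for each $S\in\mathcal{F}$, every dominating set adjacent to $S$ belongs to $\mathcal{F}$. An autonomous dominating set is a member of some autonomously dominating family; $\gamma_{\mathrm{aut}}(G)$ is the least size of one. The eternal domination number $\gamma_\infty(G)$ is the least size of a member of a nonempty family of dominating sets satisfying (1) and (2). -}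

module Defs where

open import Level using (Level)
open import Data.Nat using (ℕ; _≤_)
open import Data.Fin using (Fin)
open import Data.Fin.Subset using (Subset; _∈_; _∉_; _∪_; _-_; ⁅_⁆; ∣_∣)
open import Data.Product using (Σ; ∃; ∃-syntax; _×_; _,_)
open import Data.Sum using (_⊎_)
open import Relation.Nullary using (¬_)
open import Relation.Binary.PropositionalEquality using (_≡_)

record Graph : Set₁ where
  field
    n     : ℕ
    Adj   : Fin n → Fin n → Set
    sym   : ∀ {u v} → Adj u v → Adj v u
    irrefl : ∀ {v} → ¬ Adj v v

module _ (G : Graph) where
  open Graph G

  Dominating : Subset n → Set
  Dominating S = ∀ v → v ∈ S ⊎ ∃[ u ] (u ∈ S × Adj u v)

  AdjacentDS : Subset n → Subset n → Set
  AdjacentDS S S' =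
    Dominating S × Dominating S' ×
    ∃[ v ] ∃[ v' ] (v ∈ S × v' ∈ S' × Adj v v' × S' ≡ ((S - v) ∪ ⁅ v' ⁆))

  Family : Set₁
  Family = Subset n → Set

  Cond1 : Family → Set
  Cond1 F = ∀ S → F S → Dominating S

  Cond2 : Family → Set
  Cond2 F = ∀ S → F S → ∀ v → v ∉ S → ∃[ S' ] (F S' × AdjacentDS S S' × v ∈ S')

  Cond3 : Family → Set
  Cond3 F = ∀ S → F S → ∀ S' → Dominating S' → AdjacentDS S S' → F S'

  IsAutonomouslyDominatingFamily : Family → Set
  IsAutonomouslyDominatingFamily F = Cond1 F × Cond2 F × Cond3 F

  IsEternalFamily : Family → Set
  IsEternalFamily F = (∃[ S ] F S) × Cond1 F × Cond2 F

  IsAutonomousDominatingSet : Subset n → Set₁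
  IsAutonomousDominatingSet S =
    Σ Family λ F → IsAutonomouslyDominatingFamily F × F S

  EternalSize : ℕ → Set₁
  EternalSize k = Σ Family λ F → IsEternalFamily F × ∃[ S ] (F S × ∣ S ∣ ≡ k)

  AutSize : ℕ → Set₁
  AutSize k = ∃[ S ] (IsAutonomousDominatingSet S × ∣ S ∣ ≡ k)

IsLeast : ∀ {ℓ} → (ℕ → Set ℓ) → ℕ → Set ℓ
IsLeast P k = P k × (∀ m → P m → k ≤ m)

γ∞≡ : Graph → ℕ → Set₁
γ∞≡ G k = IsLeast (EternalSize G) k

γaut≡ : Graph → ℕ → Set₁
γaut≡ G k = IsLeast (AutSize G) k

{-# OPTIONS --safe #-}
-- An eternal family containing a singleton {x} forces every vertex v ≠ x to be
-- reachable from {x} in one move, i.e. {v} is dominating: G is complete.  In a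
-- complete graph the singletons form an autonomously dominating family, since a
-- move from a singleton always lands on a singleton.  Conversely every
-- autonomously dominating family is eternal, so γ_aut ≥ γ∞.
module Submission where

open import Defs
open import Data.Nat.Properties using (suc-injective)
open import Data.Fin using (Fin; zero; suc; _≟_)
open import Data.Fin.Subset
open import Data.Fin.Subset.Properties
  using (∪-identityˡ; x∈⁅x⁆; x∈⁅y⁆⇒x≡y; x≢y⇒x∉⁅y⁆; ∣⁅x⁆∣≡1)
open import Data.Bool using (true; false)
open import Data.Vec using (_∷_; [])
open import Data.Product using (_,_; ∃-syntax)
open import Data.Sum using (inj₁; inj₂)
open import Data.Empty using (⊥-elim)
open import Function using (_∘_)
open import Relation.Nullary using (yes; no)
open import Relation.Binary.PropositionalEquality using (_≡_; refl; sym; cong; subst)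

p─p≡⊥ : ∀ {n} (p : Subset n) → p ─ p ≡ ⊥
p─p≡⊥ []          = refl
p─p≡⊥ (true ∷ p)  = cong (false ∷_) (p─p≡⊥ p)
p─p≡⊥ (false ∷ p) = cong (false ∷_) (p─p≡⊥ p)

⁅x⁆-x∪⁅y⁆≡⁅y⁆ : ∀ {n} (x y : Fin n) → (⁅ x ⁆ - x) ∪ ⁅ y ⁆ ≡ ⁅ y ⁆
⁅x⁆-x∪⁅y⁆≡⁅y⁆ x y rewrite p─p≡⊥ ⁅ x ⁆ = ∪-identityˡ ⁅ y ⁆

∣p∣≡0⇒p≡⊥ : ∀ {n} (p : Subset n) → ∣ p ∣ ≡ 0 → p ≡ ⊥
∣p∣≡0⇒p≡⊥ []          _  = refl
∣p∣≡0⇒p≡⊥ (true ∷ p)  ()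
∣p∣≡0⇒p≡⊥ (false ∷ p) eq = cong (false ∷_) (∣p∣≡0⇒p≡⊥ p eq)

∣p∣≡1⇒p≡⁅x⁆ : ∀ {n} (p : Subset n) → ∣ p ∣ ≡ 1 → ∃[ x ] p ≡ ⁅ x ⁆
∣p∣≡1⇒p≡⁅x⁆ []          ()
∣p∣≡1⇒p≡⁅x⁆ (true ∷ p)  eq = zero , cong (true ∷_) (∣p∣≡0⇒p≡⊥ p (suc-injective eq))
∣p∣≡1⇒p≡⁅x⁆ (false ∷ p) eq with ∣p∣≡1⇒p≡⁅x⁆ p eq
... | x , p≡⁅x⁆ = suc x , cong (false ∷_) p≡⁅x⁆

module _ (G : Graph) where
  open Graph G using (Adj)

  Singletons : Family G
  Singletons S = ∃[ x ] S ≡ ⁅ x ⁆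

  dominating-⁅v⁆⇒Adj : ∀ {v w} → Dominating G ⁅ v ⁆ → w ∉ ⁅ v ⁆ → Adj v w
  dominating-⁅v⁆⇒Adj {v} {w} dom w∉⁅v⁆ with dom w
  ... | inj₁ w∈⁅v⁆              = ⊥-elim (w∉⁅v⁆ w∈⁅v⁆)
  ... | inj₂ (u , u∈⁅v⁆ , u~w) rewrite x∈⁅y⁆⇒x≡y v u∈⁅v⁆ = u~w

  adjacentDS-⁅x⁆⇒singleton : ∀ {x S'} → AdjacentDS G ⁅ x ⁆ S' → Singletons S'
  adjacentDS-⁅x⁆⇒singleton {x} (_ , _ , u , v' , u∈⁅x⁆ , _ , _ , S'≡)
    rewrite x∈⁅y⁆⇒x≡y x u∈⁅x⁆ | ⁅x⁆-x∪⁅y⁆≡⁅y⁆ x v' = v' , S'≡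

  adjacentDS-⁅x⁆⁅y⁆ : ∀ {x y} → Dominating G ⁅ x ⁆ → Dominating G ⁅ y ⁆ →
                      y ∉ ⁅ x ⁆ → AdjacentDS G ⁅ x ⁆ ⁅ y ⁆
  adjacentDS-⁅x⁆⁅y⁆ {x} {y} dom-x dom-y y∉⁅x⁆ =
    dom-x , dom-y , x , y , x∈⁅x⁆ x , x∈⁅x⁆ y ,
    dominating-⁅v⁆⇒Adj dom-x y∉⁅x⁆ , sym (⁅x⁆-x∪⁅y⁆≡⁅y⁆ x y)

  eternal-⁅x⁆⇒dominating-⁅v⁆ : ∀ {E x} → Cond1 G E → Cond2 G E → E ⁅ x ⁆ →
                               ∀ v → Dominating G ⁅ v ⁆
  eternal-⁅x⁆⇒dominating-⁅v⁆ {x = x} c1 c2 E-⁅x⁆ v with v ≟ x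
  ... | yes refl = c1 _ E-⁅x⁆
  ... | no v≢x with c2 _ E-⁅x⁆ v (x≢y⇒x∉⁅y⁆ v≢x)
  ... | S' , _ , adj@(_ , dom-S' , _) , v∈S' with adjacentDS-⁅x⁆⇒singleton adj
  ... | y , refl rewrite x∈⁅y⁆⇒x≡y y v∈S' = dom-S'

  singletons-autonomous : (∀ v → Dominating G ⁅ v ⁆) →
                          IsAutonomouslyDominatingFamily G Singletons
  singletons-autonomous dom = cond1 , cond2 , cond3
    where
    cond1 : Cond1 G Singletons
    cond1 _ (y , refl) = dom y

    cond2 : Cond2 G Singletons
    cond2 _ (y , refl) v v∉⁅y⁆ =
      ⁅ v ⁆ , (v , refl) , adjacentDS-⁅x⁆⁅y⁆ (dom y) (dom v) v∉⁅y⁆ , x∈⁅x⁆ v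

    cond3 : Cond3 G Singletons
    cond3 _ (_ , refl) _ _ = adjacentDS-⁅x⁆⇒singleton

  eternalSize1⇒autSize1 : EternalSize G 1 → AutSize G 1
  eternalSize1⇒autSize1 (E , (_ , c1 , c2) , S , E-S , ∣S∣≡1) with ∣p∣≡1⇒p≡⁅x⁆ S ∣S∣≡1
  ... | x , refl =
    ⁅ x ⁆ ,
    (Singletons , singletons-autonomous (eternal-⁅x⁆⇒dominating-⁅v⁆ c1 c2 E-S) , x , refl) ,
    ∣⁅x⁆∣≡1 x

  autSize⇒eternalSize : ∀ {k} → AutSize G k → EternalSize G k
  autSize⇒eternalSize (S , (F , (c1 , c2 , _) , F-S) , ∣S∣≡k) =
    F , ((S , F-S) , c1 , c2) , S , F-S , ∣S∣≡k

mainTheorem18 : (G : Graph) → γ∞≡ G 1 → γaut≡ G 1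
mainTheorem18 G (eternal₁ , least) =
  eternalSize1⇒autSize1 G eternal₁ , λ m → least m ∘ autSize⇒eternalSize G
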